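{- For all even $n \geq 4$, $\mathsf{DL}(L_{2,n}) = r(L_{2,n}) - 1 = n/2$.
   Context: $L_{m,n}$ is the $m\times n$ grid graph, i.e. the Cartesian product of a path on $m$ vertices and a path on $n$ vertices. For a finite connected graph $G=(V,E)$ with $|V|=N$ and graph distance $d$, a $k$-dispersed labelling is a bijection $\phi:\{1,\dots,N\}\to V$ with $d(\phi(i),\phi(i+1))\ge k$ for $1\le i\le N-1$; $\mathsf{DL}(G)$ is the maximum such $k$. $r(G)=\min_v\max_u d(v,u)$ is the radius. -}

module Defs where

open import Data.Nat using (ℕ; zero; suc; _≤_; _<_)
open import Data.Fin using (Fin; toℕ)
open import Data.Product using (_×_; Σ; ∃; _,_)
open import Data.Sum using (_⊎_)
open import Relation.Binary.PropositionalEquality using (_≡_)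
open import Function.Bundles using (_⤖_; Bijection)

record Graph : Set₁ where
  field
    V   : Set
    N   : ℕ          -- number of vertices |V|
    Adj : V → V → Set
open Graph public

data Walk (G : Graph) : V G → V G → ℕ → Set where
  here : ∀ {u} → Walk G u u 0
  step : ∀ {u v w ℓ} → Adj G u v → Walk G v w ℓ → Walk G u w (suc ℓ)

Dist : (G : Graph) → V G → V G → ℕ → Set
Dist G u v d = Walk G u v d × (∀ ℓ → Walk G u v ℓ → d ≤ ℓ)

-- A k-dispersed labelling: a bijection φ : {1..N} → V (here Fin N, 0-based)
-- with d(φ(i), φ(i+1)) ≥ k for consecutive labels.
Dispersed : (G : Graph) → ℕ → (Fin (N G) → V G) → Set
Dispersed G k φ = ∀ (i j : Fin (N G)) → toℕ j ≡ suc (toℕ i) →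
  ∃ λ d → Dist G (φ i) (φ j) d × k ≤ d

HasDispersedLabelling : (G : Graph) → ℕ → Set
HasDispersedLabelling G k = Σ (Fin (N G) ⤖ V G) λ φ → Dispersed G k (Bijection.to φ)

IsDL : Graph → ℕ → Set
IsDL G k = HasDispersedLabelling G k × (∀ k' → HasDispersedLabelling G k' → k' ≤ k)

Ecc : (G : Graph) → V G → ℕ → Set
Ecc G v e = (∀ u d → Dist G v u d → d ≤ e) × (∃ λ u → Dist G v u e)

IsRadius : Graph → ℕ → Set
IsRadius G r = (∃ λ v → Ecc G v r) × (∀ v e → Ecc G v e → r ≤ e)

PathAdj : (n : ℕ) → Fin n → Fin n → Set
PathAdj n i j = (suc (toℕ i) ≡ toℕ j) ⊎ (suc (toℕ j) ≡ toℕ i)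

GridAdj : (m n : ℕ) → (Fin m × Fin n) → (Fin m × Fin n) → Set
GridAdj m n (a , b) (a' , b') = (a ≡ a' × PathAdj n b b') ⊎ (PathAdj m a a' × b ≡ b')

L : ℕ → ℕ → Graph
L m n = record { V = Fin m × Fin n ; N = m Data.Nat.* n ; Adj = GridAdj m n }

module Submission where

open import Defs
open import Data.Empty using (⊥-elim)
open import Data.Fin using (Fin; toℕ; zero; fromℕ; fromℕ<; cast; combine; splitAt)
open import Data.Fin.Patterns using (0F; 1F)
open import Data.Fin.Properties
  using (toℕ-injective; toℕ-fromℕ; toℕ-fromℕ<; toℕ<n; toℕ-cast; toℕ-combine; cast-involutive;
         toℕ-↑ˡ; toℕ-↑ʳ; join-splitAt; *↔×; +↔⊎)
open import Data.Nat
  using (ℕ; zero; suc; _≤_; _<_; _+_; _*_; _/_; ∣_-_∣; z≤n; s≤s; s≤s⁻¹; _≟_; _≤?_)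
open import Data.Nat.Divisibility using (_∣_; divides)
open import Data.Nat.DivMod using (m*n/n≡m)
open import Data.Nat.Properties
open import Algebra.Properties.CommutativeSemigroup +-commutativeSemigroup using (interchange)
open import Data.Product using (_×_; ∃; _,_; proj₁; proj₂)
open import Data.Sum using (_⊎_; inj₁; inj₂; [_,_])
open import Data.Sum.Properties using (swap-↔)
open import Function using (_∘_)
open import Function.Bundles using (_⤖_; _↔_; Bijection; Inverse; mk↔ₛ′)
open import Function.Properties.Inverse using (↔-trans; ↔-sym; ↔⇒⤖)
open import Relation.Binary.Definitions using (Symmetric)
open import Relation.Binary.PropositionalEquality
  using (_≡_; _≢_; refl; sym; trans; cong; cong₂; subst)
open import Relation.Nullary using (¬_; yes; no; contradiction)

-- Distances in L_{a,b} are Manhattan distances. Write n = 2m and let σ be the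
-- half-turn c ↦ c + m (mod n) of the columns. Giving label 2h the vertex (0, h)
-- and label 2h + 1 the vertex (1, σ h) puts consecutive labels in different
-- rows at column distance m or at least m − 1, so at distance at least m.
-- Conversely, each of (0, m − 1), (1, m − 1) and (0, m) has a single vertex at
-- distance m + 1, the far corner of the other row; in an (m + 1)-dispersed
-- labelling both neighbours of its label would be that corner, so it must carry
-- the first or the last label, which three vertices cannot all do. For the
-- radius, (0, m) reaches everything within m + 1, and every vertex is at
-- distance at least m + 1 from one of the corners of the other row.

∣n-1+n∣≡1 : ∀ n → ∣ n - suc n ∣ ≡ 1
∣n-1+n∣≡1 zero    = refl
∣n-1+n∣≡1 (suc n) = ∣n-1+n∣≡1 n

∣1+n-n∣≡1 : ∀ n → ∣ suc n - n ∣ ≡ 1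
∣1+n-n∣≡1 n = trans (∣-∣-comm (suc n) n) (∣n-1+n∣≡1 n)

∣n-m+n∣≡m : ∀ m n → ∣ n - m + n ∣ ≡ m
∣n-m+n∣≡m m n = trans (cong (∣ n -_∣) (+-comm m n)) (∣m-m+n∣≡n n m)

∣-∣≤ : ∀ {k x y} → x ≤ y + k → y ≤ x + k → ∣ x - y ∣ ≤ k
∣-∣≤ {k} {x} {y} x≤y+k y≤x+k with ≤-total x y
... | inj₁ x≤y rewrite m≤n⇒∣m-n∣≡n∸m x≤y = m≤n+o⇒m∸n≤o y x y≤x+k
... | inj₂ y≤x rewrite m≤n⇒∣n-m∣≡n∸m y≤x = m≤n+o⇒m∸n≤o x y x≤y+k

≤∣-∣⇒ : ∀ {k x y} → k ≤ ∣ x - y ∣ → x + k ≤ y ⊎ y + k ≤ x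
≤∣-∣⇒ {k} {x} {y} k≤ with ≤-total x y
... | inj₁ x≤y rewrite m≤n⇒∣m-n∣≡n∸m x≤y =
  inj₁ (subst (_≤ y) (+-comm k x) (m≤o∸n⇒m+n≤o k x≤y k≤))
... | inj₂ y≤x rewrite m≤n⇒∣n-m∣≡n∸m y≤x =
  inj₂ (subst (_≤ x) (+-comm k y) (m≤o∸n⇒m+n≤o k y≤x k≤))

≤∣-∣⇐ : ∀ {k x y} → x + k ≤ y ⊎ y + k ≤ x → k ≤ ∣ x - y ∣
≤∣-∣⇐ {k} {x} {y} (inj₁ x+k≤y) rewrite m≤n⇒∣m-n∣≡n∸m (≤-trans (m≤m+n x k) x+k≤y) =
  m+n≤o⇒m≤o∸n k (subst (_≤ y) (+-comm x k) x+k≤y)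
≤∣-∣⇐ {k} {x} {y} (inj₂ y+k≤x) rewrite m≤n⇒∣n-m∣≡n∸m (≤-trans (m≤m+n y k) y+k≤x) =
  m+n≤o⇒m≤o∸n k (subst (_≤ x) (+-comm y k) y+k≤x)

suc-2*+bit : ∀ x y (p q : Fin 2) → 2 * x + toℕ q ≡ suc (2 * y + toℕ p) →
             (p ≡ 0F × q ≡ 1F × x ≡ y) ⊎ (p ≡ 1F × q ≡ 0F × x ≡ suc y)
suc-2*+bit x y 0F 0F eq =
  contradiction (trans (sym (+-identityʳ _)) (trans eq (cong suc (+-identityʳ _)))) (even≢odd x y)
suc-2*+bit x y 0F 1F eq = inj₁ (refl , refl , *-cancelˡ-≡ x y 2
  (suc-injective (trans (+-comm 1 _) (trans eq (cong suc (+-identityʳ _))))))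
suc-2*+bit x y 1F 0F eq = inj₂ (refl , refl , *-cancelˡ-≡ x (suc y) 2
  (trans (sym (+-identityʳ _)) (trans eq (trans (cong suc (+-comm (2 * y) 1)) (sym (*-suc 2 y))))))
suc-2*+bit x y 1F 1F eq =
  contradiction (suc-injective (trans (+-comm 1 _) (trans eq (cong suc (+-comm _ 1))))) (even≢odd x y)

module _ {G : Graph} where

  _++ᵂ_ : ∀ {u v w k l} → Walk G u v k → Walk G v w l → Walk G u w (k + l)
  here     ++ᵂ q = q
  step e p ++ᵂ q = step e (p ++ᵂ q)

  Walk-snoc : ∀ {u v w ℓ} → Walk G u v ℓ → Adj G v w → Walk G u w (suc ℓ)
  Walk-snoc here       e = step e here
  Walk-snoc (step a p) e = step a (Walk-snoc p e)

  Walk-reverse : Symmetric (Adj G) → ∀ {u v ℓ} → Walk G u v ℓ → Walk G v u ℓ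
  Walk-reverse sym-adj here       = here
  Walk-reverse sym-adj (step e p) = Walk-snoc (Walk-reverse sym-adj p) (sym-adj e)

  Dist-sym : Symmetric (Adj G) → ∀ {u v d} → Dist G u v d → Dist G v u d
  Dist-sym sym-adj (p , shortest) =
    Walk-reverse sym-adj p , λ ℓ q → shortest ℓ (Walk-reverse sym-adj q)

  walk-length-≥ : (δ : V G → V G → ℕ) → (∀ u → δ u u ≡ 0) →
                  (∀ u v w → δ u w ≤ δ u v + δ v w) → (∀ {u v} → Adj G u v → δ u v ≤ 1) →
                  ∀ {u v ℓ} → Walk G u v ℓ → δ u v ≤ ℓ
  walk-length-≥ δ δ-refl δ-tri δ-adj {u} here = ≤-reflexive (δ-refl u)
  walk-length-≥ δ δ-refl δ-tri δ-adj {u} {w} (step {v = v} e p) =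
    ≤-trans (δ-tri u v w) (+-mono-≤ (δ-adj e) (walk-length-≥ δ δ-refl δ-tri δ-adj p))

Walk-map : ∀ {G H} (f : V G → V H) → (∀ {u v} → Adj G u v → Adj H (f u) (f v)) →
           ∀ {u v ℓ} → Walk G u v ℓ → Walk H (f u) (f v) ℓ
Walk-map f f-adj here       = here
Walk-map f f-adj (step e p) = step (f-adj e) (Walk-map f f-adj p)

Far : (G : Graph) → ℕ → V G → V G → Set
Far G k u v = ∃ λ d → Dist G u v d × k ≤ d

Far-sym : ∀ {G k} → Symmetric (Adj G) → ∀ {u v} → Far G k u v → Far G k v u
Far-sym sym-adj (d , D , k≤d) = d , Dist-sym sym-adj D , k≤d

AtMostOneFar : (G : Graph) → ℕ → V G → Set
AtMostOneFar G k x = ∀ {y z} → Far G k x y → Far G k x z → y ≡ z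

Endpoint : ℕ → ℕ → Set
Endpoint N i = i ≡ 0 ⊎ suc i ≡ N

HasDispersedLabelling-mono : ∀ {G k k'} → k ≤ k' →
                             HasDispersedLabelling G k' → HasDispersedLabelling G k
HasDispersedLabelling-mono k≤k' (φ , dispersed) = φ , λ i j j≡1+i →
  let d , D , k'≤d = dispersed i j j≡1+i in d , D , ≤-trans k≤k' k'≤d

module _ {G : Graph} {k : ℕ} (sym-adj : Symmetric (Adj G)) where

  -- The two labels next to an interior label carry distinct vertices, both far from it.
  at-most-one-far⇒endpoint : (φ : Fin (N G) ⤖ V G) → Dispersed G k (Bijection.to φ) →
                             ∀ i → AtMostOneFar G k (Bijection.to φ i) → Endpoint (N G) (toℕ i)
  at-most-one-far⇒endpoint φ dispersed i unique with toℕ i in i≡1+t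
  ... | zero = inj₁ refl
  ... | suc t with suc (suc t) ≟ N G
  ...   | yes last    = inj₂ last
  ...   | no not-last = contradiction (cong toℕ (injective (unique far⁻ far⁺))) t≢2+t
    where
    open Bijection φ using (injective)
    i<N : suc t < N G
    i<N = subst (_< N G) i≡1+t (toℕ<n i)
    t<N : t < N G
    t<N = <-trans (n<1+n t) i<N
    2+t<N : suc (suc t) < N G
    2+t<N = ≤∧≢⇒< i<N not-last
    far⁻ : Far G k (Bijection.to φ i) (Bijection.to φ (fromℕ< t<N))
    far⁻ = Far-sym sym-adj (dispersed _ i (trans i≡1+t (cong suc (sym (toℕ-fromℕ< t<N)))))
    far⁺ : Far G k (Bijection.to φ i) (Bijection.to φ (fromℕ< 2+t<N))
    far⁺ = dispersed i _ (trans (toℕ-fromℕ< 2+t<N) (cong suc (sym i≡1+t)))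
    t≢2+t : toℕ (fromℕ< t<N) ≢ toℕ (fromℕ< 2+t<N)
    t≢2+t eq = m≢1+n+m t (trans (sym (toℕ-fromℕ< t<N)) (trans eq (toℕ-fromℕ< 2+t<N)))

  endpoints-collide : ∀ {N a b c} → Endpoint N a → Endpoint N b → Endpoint N c →
                      a ≡ b ⊎ a ≡ c ⊎ b ≡ c
  endpoints-collide (inj₁ a≡0) (inj₁ b≡0) _          = inj₁ (trans a≡0 (sym b≡0))
  endpoints-collide (inj₂ a≡N) (inj₂ b≡N) _          = inj₁ (suc-injective (trans a≡N (sym b≡N)))
  endpoints-collide (inj₁ a≡0) (inj₂ _)   (inj₁ c≡0) = inj₂ (inj₁ (trans a≡0 (sym c≡0)))
  endpoints-collide (inj₂ a≡N) (inj₁ _)   (inj₂ c≡N) = inj₂ (inj₁ (suc-injective (trans a≡N (sym c≡N))))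
  endpoints-collide (inj₁ _)   (inj₂ b≡N) (inj₂ c≡N) = inj₂ (inj₂ (suc-injective (trans b≡N (sym c≡N))))
  endpoints-collide (inj₂ _)   (inj₁ b≡0) (inj₁ c≡0) = inj₂ (inj₂ (trans b≡0 (sym c≡0)))

  three-at-most-one-far⇒no-labelling : ∀ {x y z} → x ≢ y → x ≢ z → y ≢ z →
    AtMostOneFar G k x → AtMostOneFar G k y → AtMostOneFar G k z → ¬ HasDispersedLabelling G k
  three-at-most-one-far⇒no-labelling {x} {y} {z} x≢y x≢z y≢z ux uy uz (φ , dispersed) =
    [ x≢y ∘ same-label x y , [ x≢z ∘ same-label x z , y≢z ∘ same-label y z ] ]
      (endpoints-collide (endpoint x ux) (endpoint y uy) (endpoint z uz))
    where
    open Bijection φ using (to; strictlySurjective)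
    label : V G → Fin (N G)
    label v = proj₁ (strictlySurjective v)
    endpoint : ∀ v → AtMostOneFar G k v → Endpoint (N G) (toℕ (label v))
    endpoint v uv = at-most-one-far⇒endpoint φ dispersed (label v)
      (subst (AtMostOneFar G k) (sym (proj₂ (strictlySurjective v))) uv)
    same-label : ∀ v w → toℕ (label v) ≡ toℕ (label w) → v ≡ w
    same-label v w eq = trans (sym (proj₂ (strictlySurjective v)))
      (trans (cong to (toℕ-injective eq)) (proj₂ (strictlySurjective w)))

P : ℕ → Graph
P n = record { V = Fin n ; N = n ; Adj = PathAdj n }

PathAdj-sym : ∀ {n} → Symmetric (PathAdj n)
PathAdj-sym (inj₁ e) = inj₂ e
PathAdj-sym (inj₂ e) = inj₁ e

GridAdj-sym : ∀ {a b} → Symmetric (GridAdj a b)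
GridAdj-sym (inj₁ (e , p)) = inj₁ (sym e , PathAdj-sym p)
GridAdj-sym (inj₂ (p , e)) = inj₂ (PathAdj-sym p , sym e)

PathAdj⇒∣-∣≡1 : ∀ {n} {i j : Fin n} → PathAdj n i j → ∣ toℕ i - toℕ j ∣ ≡ 1
PathAdj⇒∣-∣≡1 {i = i} (inj₁ e) = trans (cong (∣ toℕ i -_∣) (sym e)) (∣n-1+n∣≡1 (toℕ i))
PathAdj⇒∣-∣≡1 {j = j} (inj₂ e) = trans (cong (∣_- toℕ j ∣) (sym e)) (∣1+n-n∣≡1 (toℕ j))

ascend : ∀ {n} k (i j : Fin n) → toℕ i + k ≡ toℕ j → Walk (P n) i j k
ascend zero i j i+0≡j with toℕ-injective {i = i} {j} (trans (sym (+-identityʳ _)) i+0≡j)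
... | refl = here
ascend {n} (suc k) i j i+1+k≡j = step (inj₁ (sym (toℕ-fromℕ< 1+i<n)))
  (ascend k (fromℕ< 1+i<n) j (trans (cong (_+ k) (toℕ-fromℕ< 1+i<n)) 1+i+k≡j))
  where
  1+i+k≡j : suc (toℕ i) + k ≡ toℕ j
  1+i+k≡j = trans (sym (+-suc (toℕ i) k)) i+1+k≡j
  1+i<n : suc (toℕ i) < n
  1+i<n = ≤-<-trans (≤-trans (m≤m+n (suc (toℕ i)) k) (≤-reflexive 1+i+k≡j)) (toℕ<n j)

path-walk : ∀ {n} (i j : Fin n) → Walk (P n) i j ∣ toℕ i - toℕ j ∣
path-walk i j with ≤-total (toℕ i) (toℕ j)
... | inj₁ i≤j = subst (Walk _ i j) (sym (m≤n⇒∣m-n∣≡n∸m i≤j)) (ascend _ i j (m+[n∸m]≡n i≤j))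
... | inj₂ j≤i = subst (Walk _ i j) (sym (m≤n⇒∣n-m∣≡n∸m j≤i))
                       (Walk-reverse PathAdj-sym (ascend _ j i (m+[n∸m]≡n j≤i)))

manhattan : ∀ {a b} → Fin a × Fin b → Fin a × Fin b → ℕ
manhattan (i , j) (i' , j') = ∣ toℕ i - toℕ i' ∣ + ∣ toℕ j - toℕ j' ∣

manhattan-walk : ∀ {a b} (u v : Fin a × Fin b) → Walk (L a b) u v (manhattan u v)
manhattan-walk (i , j) (i' , j') =
  Walk-map (_, j) (λ p → inj₂ (p , refl)) (path-walk i i') ++ᵂ
  Walk-map (i' ,_) (λ p → inj₁ (refl , p)) (path-walk j j')

manhattan-self : ∀ {a b} (u : Fin a × Fin b) → manhattan u u ≡ 0
manhattan-self (i , j) rewrite ∣n-n∣≡0 (toℕ i) | ∣n-n∣≡0 (toℕ j) = refl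

manhattan-adj : ∀ {a b} {u v : Fin a × Fin b} → GridAdj a b u v → manhattan u v ≤ 1
manhattan-adj {u = i , _} (inj₁ (refl , p)) rewrite ∣n-n∣≡0 (toℕ i) | PathAdj⇒∣-∣≡1 p = ≤-refl
manhattan-adj {u = _ , j} (inj₂ (p , refl)) rewrite ∣n-n∣≡0 (toℕ j) | PathAdj⇒∣-∣≡1 p = ≤-refl

manhattan-triangle : ∀ {a b} (u v w : Fin a × Fin b) →
                     manhattan u w ≤ manhattan u v + manhattan v w
manhattan-triangle (i , j) (i' , j') (i'' , j'') = ≤-trans
  (+-mono-≤ (∣-∣-triangle (toℕ i) (toℕ i') (toℕ i'')) (∣-∣-triangle (toℕ j) (toℕ j') (toℕ j'')))
  (≤-reflexive (interchange ∣ toℕ i - toℕ i' ∣ ∣ toℕ i' - toℕ i'' ∣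
                             ∣ toℕ j - toℕ j' ∣ ∣ toℕ j' - toℕ j'' ∣))

Dist-L : ∀ {a b} (u v : Fin a × Fin b) → Dist (L a b) u v (manhattan u v)
Dist-L u v = manhattan-walk u v ,
  λ ℓ p → walk-length-≥ manhattan manhattan-self manhattan-triangle manhattan-adj p

≤manhattan⇒Far : ∀ {a b k} {u v : Fin a × Fin b} → k ≤ manhattan u v → Far (L a b) k u v
≤manhattan⇒Far {u = u} {v} k≤ = manhattan u v , Dist-L u v , k≤

Far⇒≤manhattan : ∀ {a b k} {u v : Fin a × Fin b} → Far (L a b) k u v → k ≤ manhattan u v
Far⇒≤manhattan {u = u} {v} (_ , (_ , shortest) , k≤d) = ≤-trans k≤d (shortest _ (manhattan-walk u v))

∣-∣≤1 : ∀ (a a' : Fin 2) → ∣ toℕ a - toℕ a' ∣ ≤ 1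
∣-∣≤1 0F 0F = z≤n
∣-∣≤1 0F 1F = ≤-refl
∣-∣≤1 1F 0F = ≤-refl
∣-∣≤1 1F 1F = z≤n

other : Fin 2 → Fin 2
other 0F = 1F
other 1F = 0F

1≤∣a-other-a∣ : ∀ a → 1 ≤ ∣ toℕ a - toℕ (other a) ∣
1≤∣a-other-a∣ 0F = ≤-refl
1≤∣a-other-a∣ 1F = ≤-refl

≢⇒other : ∀ {a a' : Fin 2} → a ≢ a' → a' ≡ other a
≢⇒other {0F} {0F} a≢a' = ⊥-elim (a≢a' refl)
≢⇒other {0F} {1F} _    = refl
≢⇒other {1F} {0F} _    = refl
≢⇒other {1F} {1F} a≢a' = ⊥-elim (a≢a' refl)

far-in-ladder : ∀ {n m} (a a' : Fin 2) (c c' : Fin n) → ∣ toℕ c - toℕ c' ∣ ≤ m →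
                suc m ≤ manhattan (a , c) (a' , c') → a ≢ a' × m ≤ ∣ toℕ c - toℕ c' ∣
far-in-ladder {m = m} a a' c c' s≤m far =
  other-row , +-cancelˡ-≤ 1 m _ (≤-trans far (+-monoˡ-≤ _ (∣-∣≤1 a a')))
  where
  other-row : a ≢ a'
  other-row refl = <⇒≱ (subst (λ r → suc m ≤ r + ∣ toℕ c - toℕ c' ∣) (∣n-n∣≡0 (toℕ a)) far) s≤m

at-most-one-far-in-ladder : ∀ {n m} (a : Fin 2) (c : Fin n) (t : ℕ) →
  (∀ c' → ∣ toℕ c - toℕ c' ∣ ≤ m) → (∀ c' → m ≤ ∣ toℕ c - toℕ c' ∣ → toℕ c' ≡ t) →
  AtMostOneFar (L 2 n) (suc m) (a , c)
at-most-one-far-in-ladder a c t bounded only-t {a' , c'} {a'' , c''} far' far''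
  with far-in-ladder a a' c c' (bounded c') (Far⇒≤manhattan far')
     | far-in-ladder a a'' c c'' (bounded c'') (Far⇒≤manhattan far'')
... | a≢a' , gap' | a≢a'' , gap'' = cong₂ _,_
  (trans (≢⇒other a≢a') (sym (≢⇒other a≢a'')))
  (toℕ-injective (trans (only-t c' gap') (sym (only-t c'' gap''))))

cast↔ : ∀ {a b} → a ≡ b → Fin a ↔ Fin b
cast↔ eq = mk↔ₛ′ (cast eq) (cast (sym eq)) (cast-involutive eq (sym eq)) (cast-involutive (sym eq) eq)

module LadderLabelling {n : ℕ} (σ : Fin n ↔ Fin n) where
  open Inverse σ using (strictlyInverseˡ; strictlyInverseʳ) renaming (to to σ⁺; from to σ⁻)

  turn : Fin 2 → Fin n → Fin n
  turn 0F c = c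
  turn 1F c = σ⁺ c

  unturn : Fin 2 → Fin n → Fin n
  unturn 0F h = h
  unturn 1F h = σ⁻ h

  rungs : (Fin n × Fin 2) ↔ (Fin 2 × Fin n)
  rungs = mk↔ₛ′ climb descend climb-descend descend-climb
    where
    climb : Fin n × Fin 2 → Fin 2 × Fin n
    climb (h , p) = p , unturn p h
    descend : Fin 2 × Fin n → Fin n × Fin 2
    descend (p , c) = turn p c , p
    climb-descend : ∀ v → climb (descend v) ≡ v
    climb-descend (0F , c) = refl
    climb-descend (1F , c) = cong (1F ,_) (strictlyInverseʳ c)
    descend-climb : ∀ v → descend (climb v) ≡ v
    descend-climb (h , 0F) = refl
    descend-climb (h , 1F) = cong (_, 1F) (strictlyInverseˡ h)

  -- Label 2h + p is the vertex (p , unturn p h).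
  labelling : Fin (2 * n) ↔ (Fin 2 × Fin n)
  labelling = ↔-trans (cast↔ (*-comm 2 n)) (↔-trans *↔× rungs)

  open Inverse labelling using (to; from) renaming (strictlyInverseʳ to from-to)

  toℕ-from : ∀ p c → toℕ (from (p , c)) ≡ 2 * toℕ (turn p c) + toℕ p
  toℕ-from p c = trans (toℕ-cast _ (combine (turn p c) p)) (toℕ-combine (turn p c) p)

  dispersed : ∀ {k} → (∀ c → k ≤ ∣ toℕ (σ⁺ c) - toℕ c ∣) → Dispersed (L 2 n) k to
  dispersed {k} displaced i j j≡1+i = ≤manhattan⇒Far (consecutive (to i) (to j) labels)
    where
    labels : toℕ (from (to j)) ≡ suc (toℕ (from (to i)))
    labels rewrite from-to i | from-to j = j≡1+i
    consecutive : ∀ v w → toℕ (from w) ≡ suc (toℕ (from v)) → k ≤ manhattan v w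
    consecutive (p , c) (q , c') eq
      with suc-2*+bit (toℕ (turn q c')) (toℕ (turn p c)) p q
             (trans (sym (toℕ-from q c')) (trans eq (cong suc (toℕ-from p c))))
    ... | inj₁ (refl , refl , σc'≡c) =
      m≤n⇒m≤1+n (subst (λ t → k ≤ ∣ t - toℕ c' ∣) σc'≡c (displaced c'))
    ... | inj₂ (refl , refl , c'≡1+σc) = begin
      k                                            ≤⟨ displaced c ⟩
      ∣ toℕ (σ⁺ c) - toℕ c ∣                       ≡⟨ ∣-∣-comm (toℕ (σ⁺ c)) (toℕ c) ⟩
      ∣ toℕ c - toℕ (σ⁺ c) ∣                       ≤⟨ ∣-∣-triangle (toℕ c) (toℕ c') (toℕ (σ⁺ c)) ⟩
      ∣ toℕ c - toℕ c' ∣ + ∣ toℕ c' - toℕ (σ⁺ c) ∣ ≡⟨ cong (∣ toℕ c - toℕ c' ∣ +_) step≡1 ⟩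
      ∣ toℕ c - toℕ c' ∣ + 1                       ≡⟨ +-comm ∣ toℕ c - toℕ c' ∣ 1 ⟩
      suc ∣ toℕ c - toℕ c' ∣                       ∎
      where
      open ≤-Reasoning
      step≡1 : ∣ toℕ c' - toℕ (σ⁺ c) ∣ ≡ 1
      step≡1 = trans (cong (∣_- toℕ (σ⁺ c) ∣) c'≡1+σc) (∣1+n-n∣≡1 (toℕ (σ⁺ c)))

halfTurn : ∀ m → Fin (m + m) ↔ Fin (m + m)
halfTurn m = ↔-trans (+↔⊎ {m} {m}) (↔-trans swap-↔ (↔-sym (+↔⊎ {m} {m})))

halfTurn-displacement : ∀ m (c : Fin (m + m)) → ∣ toℕ (Inverse.to (halfTurn m) c) - toℕ c ∣ ≡ m
halfTurn-displacement m c with splitAt m c | join-splitAt m m c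
... | inj₁ i | refl rewrite toℕ-↑ʳ m i | toℕ-↑ˡ i m =
  trans (∣-∣-comm (m + toℕ i) (toℕ i)) (∣n-m+n∣≡m m (toℕ i))
... | inj₂ i | refl rewrite toℕ-↑ʳ m i | toℕ-↑ˡ i m = ∣n-m+n∣≡m m (toℕ i)

module EvenLadder (m₁ : ℕ) where
  m n : ℕ
  m = suc m₁
  n = m + m

  column≤ : ∀ (c : Fin n) → toℕ c ≤ m₁ + m
  column≤ c = s≤s⁻¹ (toℕ<n c)

  lower-middle upper-middle : Fin n
  lower-middle = fromℕ< {m₁} (m≤m+n m m)
  upper-middle = fromℕ< {m} (s≤s (m≤n+m m m₁))

  toℕ-lower-middle : toℕ lower-middle ≡ m₁
  toℕ-lower-middle = toℕ-fromℕ< (m≤m+n m m)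

  toℕ-upper-middle : toℕ upper-middle ≡ m
  toℕ-upper-middle = toℕ-fromℕ< (s≤s (m≤n+m m m₁))

  lower-middle-bounded : ∀ c → ∣ toℕ lower-middle - toℕ c ∣ ≤ m
  lower-middle-bounded c rewrite toℕ-lower-middle =
    ∣-∣≤ (≤-trans (n≤1+n m₁) (m≤n+m m (toℕ c))) (column≤ c)

  upper-middle-bounded : ∀ c → ∣ toℕ upper-middle - toℕ c ∣ ≤ m
  upper-middle-bounded c rewrite toℕ-upper-middle =
    ∣-∣≤ (m≤n+m m (toℕ c)) (≤-trans (column≤ c) (+-monoˡ-≤ m (n≤1+n m₁)))

  lower-middle-far : ∀ c → m ≤ ∣ toℕ lower-middle - toℕ c ∣ → toℕ c ≡ m₁ + m
  lower-middle-far c gap rewrite toℕ-lower-middle with ≤∣-∣⇒ gap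
  ... | inj₁ m₁+m≤c = ≤-antisym (column≤ c) m₁+m≤c
  ... | inj₂ c+m≤m₁ = contradiction (≤-trans (m≤n+m m (toℕ c)) c+m≤m₁) 1+n≰n

  upper-middle-far : ∀ c → m ≤ ∣ toℕ upper-middle - toℕ c ∣ → toℕ c ≡ 0
  upper-middle-far c gap rewrite toℕ-upper-middle with ≤∣-∣⇒ gap
  ... | inj₁ m+m≤c = contradiction (≤-trans m+m≤c (column≤ c)) 1+n≰n
  ... | inj₂ c+m≤m = n≤0⇒n≡0 (+-cancelʳ-≤ m (toℕ c) 0 c+m≤m)

  has-dispersed-labelling : HasDispersedLabelling (L 2 n) m
  has-dispersed-labelling = ↔⇒⤖ (LadderLabelling.labelling (halfTurn m)) ,
    LadderLabelling.dispersed (halfTurn m) (λ c → ≤-reflexive (sym (halfTurn-displacement m c)))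

  no-sharper-labelling : ¬ HasDispersedLabelling (L 2 n) (suc m)
  no-sharper-labelling = three-at-most-one-far⇒no-labelling GridAdj-sym (λ ()) lower≢upper (λ ())
    (lower-unique 0F) (lower-unique 1F)
    (at-most-one-far-in-ladder 0F upper-middle 0 upper-middle-bounded upper-middle-far)
    where
    lower-unique : ∀ a → AtMostOneFar (L 2 n) (suc m) (a , lower-middle)
    lower-unique a = at-most-one-far-in-ladder a lower-middle (m₁ + m) lower-middle-bounded lower-middle-far
    lower≢upper : (0F , lower-middle) ≢ (0F , upper-middle)
    lower≢upper eq = 1+n≰n (≤-reflexive
      (trans (sym toℕ-upper-middle) (trans (cong (toℕ ∘ proj₂) (sym eq)) toℕ-lower-middle)))

  far-corner : ∀ (v : Fin 2 × Fin n) → ∃ λ w → suc m ≤ manhattan v w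
  far-corner (a , c) with m ≤? toℕ c
  ... | yes m≤c = (other a , zero) , +-mono-≤ (1≤∣a-other-a∣ a) (≤∣-∣⇐ (inj₂ m≤c))
  ... | no  m≰c = (other a , fromℕ (m₁ + m)) , +-mono-≤ (1≤∣a-other-a∣ a) (≤∣-∣⇐ (inj₁ c+m≤last))
    where
    c+m≤last : toℕ c + m ≤ toℕ (fromℕ (m₁ + m))
    c+m≤last = subst (toℕ c + m ≤_) (sym (toℕ-fromℕ (m₁ + m))) (+-monoˡ-≤ m (s≤s⁻¹ (≰⇒> m≰c)))

  center : Fin 2 × Fin n
  center = 0F , upper-middle

  center-eccentricity : Ecc (L 2 n) center (m + 1)
  center-eccentricity =
    within , (1F , zero) , subst (Dist (L 2 n) center (1F , zero)) attained (Dist-L center (1F , zero))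
    where
    within : ∀ u d → Dist (L 2 n) center u d → d ≤ m + 1
    within u@(a , c) d (_ , shortest) = ≤-trans (shortest _ (manhattan-walk center u))
      (subst (manhattan center u ≤_) (+-comm 1 m) (+-mono-≤ (∣-∣≤1 0F a) (upper-middle-bounded c)))
    attained : manhattan center (1F , zero) ≡ m + 1
    attained = trans (cong (λ x → suc ∣ x - 0 ∣) toℕ-upper-middle) (+-comm 1 m)

  eccentricity-≥ : ∀ v e → Ecc (L 2 n) v e → m + 1 ≤ e
  eccentricity-≥ v e (within , _) with far-corner v
  ... | w , far = subst (_≤ e) (+-comm 1 m) (≤-trans far (within w _ (Dist-L v w)))

  isDL : IsDL (L 2 n) m
  isDL = has-dispersed-labelling ,
    λ k labelled → ≮⇒≥ λ m<k → no-sharper-labelling (HasDispersedLabelling-mono m<k labelled)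

  isRadius : IsRadius (L 2 n) (m + 1)
  isRadius = (center , center-eccentricity) , eccentricity-≥

theorem2p9 : ∀ (n : ℕ) → 2 ∣ n → 4 ≤ n →
    IsDL (L 2 n) (n / 2) × IsRadius (L 2 n) (n / 2 + 1)
theorem2p9 .(0 * 2) (divides zero refl) ()
theorem2p9 n (divides (suc m₁) n≡m*2) _ =
  subst (λ n → IsDL (L 2 n) (n / 2) × IsRadius (L 2 n) (n / 2 + 1)) (sym n≡m+m)
    (subst (λ k → IsDL (L 2 (m + m)) k × IsRadius (L 2 (m + m)) (k + 1)) (sym half) (isDL , isRadius))
  where
  open EvenLadder m₁ using (m; isDL; isRadius)
  n≡m+m : n ≡ m + m
  n≡m+m = trans n≡m*2 (trans (*-comm m 2) (cong (m +_) (+-identityʳ m)))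
  half : (m + m) / 2 ≡ m
  half = trans (cong (_/ 2) (trans (sym n≡m+m) n≡m*2)) (m*n/n≡m m 2)
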